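{- Let $\dot G\in\mathcal C_1\cup\mathcal C_4\cup\mathcal C_5$ be a connected, non-complete, $6$-regular and $2$ net-regular strongly regular signed graph with parameters $(n,6,a,b,c)$. If every triangle of $\dot G$ is balanced, then $(a,b)\neq(3,-2)$.
   Context: Signed graphs. - A signed graph $\dot G=(G,\sigma)$ is a simple graph $G$ (the underlying graph) with a sign function $\sigma:E(G)\to\{\pm1\}$. - The adjacency matrix has entries $\sigma(v_iv_j)$ for adjacent pairs and $0$ otherwise. - Connected, complete and regular refer to $G$. - $\dot G$ is $\rho$ net-regular if every vertex has (number of positive incident edges) $-$ (number of negative incident edges) $=\rho$. - $\dot G$ is homogeneous if all edges have the same sign. - A triangle is balanced if the product of its edge signs is $+1$. Strongly regular signed graphs. - An SRSG is a signed graph on $n$ vertices, neither homogeneous complete nor edgeless, for which there are $r\in\mathbb N$ and $a,b,c\in\mathbb Z$ such that the entries of $A(\dot G)^2$ are: - $r$ on the diagonal; - $a$ for pairs joined by a positive edge; - $b$ for pairs joined by a negative edge; - $c$ for distinct non-adjacent pairs. - $(n,r,a,b,c)$ are its parameters. Classes of inhomogeneous SRSGs. - $\mathcal C_1$: $a=-b$, and either complete, or non-complete with $c\ne0$. - $\mathcal C_4$: $a\ne-b$, non-complete, $c=0$. - $\mathcal C_5$: $a\ne-b$, non-complete, $c\ne\frac{a+b}2$ and $c\neq0$. -}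

module Defs where

open import Data.Nat using (ℕ; zero; suc)
open import Data.Integer using (ℤ; +_; -_; _+_; _*_; ∣_∣)
open import Data.Fin using (Fin; zero; suc)
open import Data.Product using (Σ; _×_; _,_; ∃-syntax)
open import Data.Sum using (_⊎_)
open import Relation.Binary.PropositionalEquality using (_≡_; _≢_)
open import Relation.Nullary using (¬_)

∑ : (n : ℕ) → (Fin n → ℤ) → ℤ
∑ zero    f = + 0
∑ (suc n) f = f zero + ∑ n (λ k → f (suc k))

record SignedGraph (n : ℕ) : Set where
  field
    A      : Fin n → Fin n → ℤ
    entry  : ∀ i j → (A i j ≡ + 0) ⊎ (A i j ≡ + 1) ⊎ (A i j ≡ - (+ 1))
    symm   : ∀ i j → A i j ≡ A j i
    noLoop : ∀ i → A i i ≡ + 0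
open SignedGraph public

module _ {n : ℕ} (G : SignedGraph n) where

  Adj : Fin n → Fin n → Set
  Adj i j = A G i j ≢ + 0

  PosEdge : Fin n → Fin n → Set
  PosEdge i j = A G i j ≡ + 1

  NegEdge : Fin n → Fin n → Set
  NegEdge i j = A G i j ≡ - (+ 1)

  A² : Fin n → Fin n → ℤ
  A² i j = ∑ n (λ k → A G i k * A G k j)

  degree : Fin n → ℤ
  degree i = ∑ n (λ k → + ∣ A G i k ∣)

  netDegree : Fin n → ℤ
  netDegree i = ∑ n (λ k → A G i k)

  Regular : ℕ → Set
  Regular r = ∀ i → degree i ≡ + r

  NetRegular : ℤ → Set
  NetRegular ρ = ∀ i → netDegree i ≡ ρ

  data Reach : Fin n → Fin n → Set where
    here : ∀ {i} → Reach i i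
    step : ∀ {i j k} → Adj i j → Reach j k → Reach i k

  Connected : Set
  Connected = ∀ i j → Reach i j

  Complete : Set
  Complete = ∀ i j → i ≢ j → Adj i j

  Edgeless : Set
  Edgeless = ∀ i j → ¬ Adj i j

  Homogeneous : Set
  Homogeneous = (∀ i j → Adj i j → PosEdge i j) ⊎ (∀ i j → Adj i j → NegEdge i j)

  IsSRSG : ℕ → ℤ → ℤ → ℤ → Set
  IsSRSG r a b c =
    ¬ (Homogeneous × Complete) × ¬ Edgeless ×
    (∀ i → A² i i ≡ + r) ×
    (∀ i j → PosEdge i j → A² i j ≡ a) ×
    (∀ i j → NegEdge i j → A² i j ≡ b) ×
    (∀ i j → i ≢ j → ¬ Adj i j → A² i j ≡ c)

  AllTrianglesBalanced : Set
  AllTrianglesBalanced = ∀ i j k → Adj i j → Adj j k → Adj k i →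
    A G i j * A G j k * A G k i ≡ + 1

  InC₁ : ℤ → ℤ → ℤ → Set
  InC₁ a b c = ¬ Homogeneous × a ≡ - b × (Complete ⊎ (¬ Complete × c ≢ + 0))

  InC₄ : ℤ → ℤ → ℤ → Set
  InC₄ a b c = ¬ Homogeneous × a ≢ - b × ¬ Complete × c ≡ + 0

  -- c ≠ (a+b)/2 written as 2c ≠ a + b
  InC₅ : ℤ → ℤ → ℤ → Set
  InC₅ a b c = ¬ Homogeneous × a ≢ - b × ¬ Complete × (+ 2 * c ≢ a + b) × c ≢ + 0

-- Fix a vertex v. Degree 6 and net degree 2 give v four positive neighbours P and two
-- negative ones Q. As all triangles are balanced, A² on an edge ij is the sign of ij times
-- the number of common neighbours of i and j, so (a, b) = (3, -2) says that every p ∈ P has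
-- three neighbours in P ∪ Q and every q ∈ Q has two. Balance also makes every edge between q
-- and P negative; q has only two negative edges and one of them goes to v, so q has exactly
-- one neighbour in P. Double counting then shows that P spans five edges: a diamond whose
-- non-adjacent tips r₁, r₂ have the positive 2-paths through v, s₁, s₂ among their at most
-- six 2-paths, whence c = A²(r₁, r₂) ≥ 0. But row v of A² sums to ρ² = 4, while its entries
-- are 6 on the diagonal, 3 on four edges, -2 on two and c elsewhere.
module Submission where

open import Defs
open import Algebra.Properties.CommutativeSemigroup using (x∙yz≈y∙xz; interchange)
import Algebra.Properties.Semiring.Sum as SemiringSum
open import Data.Bool using (true; false; if_then_else_)
open import Data.Empty using (⊥; ⊥-elim)
open import Data.Fin as Fin using (Fin; zero; suc)
open import Data.Integer as ℤ using (ℤ; +_; -_; _+_; _-_; _*_; ∣_∣; _≤_; +≤+; _≟_)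
import Data.Integer.Properties as ℤP
open import Data.List using (List; []; _∷_; map; foldr; filter; tabulate; allFin; length)
open import Data.List.Properties using (map-cong; map-cong-local)
open import Data.List.Relation.Unary.All as All using (All; []; _∷_)
open import Data.List.Relation.Unary.All.Properties using (all-filter)
open import Data.List.Relation.Unary.AllPairs using (AllPairs; []; _∷_)
open import Data.List.Relation.Unary.Unique.Propositional using (Unique)
open import Data.List.Relation.Unary.Unique.Propositional.Properties using (filter⁺; allFin⁺)
open import Data.Nat as ℕ using (ℕ; zero; suc; z≤n; s≤s)
open import Data.Nat.ListAction using (sum)
import Data.Nat.Properties as ℕP
open import Data.Nat.Tactic.RingSolver using (solve-∀)
open import Data.Product using (_×_; _,_; proj₁; proj₂)
open import Data.Sum using (_⊎_; inj₁; inj₂)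
open import Data.Vec.Functional using (updateAt)
open import Data.Vec.Functional.Properties using (updateAt-updates; updateAt-minimal)
open import Function using (_∘_; const)
open import Relation.Binary.PropositionalEquality
open import Relation.Nullary using (Dec; does; yes; no; ¬_)
open import Relation.Nullary.Decidable using (from-no)
open import Relation.Unary using (Pred; Decidable)

private
  module FinSum = SemiringSum ℤP.+-*-semiring

sum≤length : ∀ {xs} → All (ℕ._≤ 1) xs → sum xs ℕ.≤ length xs
sum≤length [] = z≤n
sum≤length (x≤1 ∷ xs≤1) = ℕP.+-mono-≤ x≤1 (sum≤length xs≤1)

length≤sum⇒all≡1 : ∀ {xs} → All (ℕ._≤ 1) xs → length xs ℕ.≤ sum xs → All (_≡ 1) xs
length≤sum⇒all≡1 [] _ = []
length≤sum⇒all≡1 {zero ∷ _} (_ ∷ xs≤1) len≤sum = ⊥-elim (ℕP.<⇒≱ len≤sum (sum≤length xs≤1))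
length≤sum⇒all≡1 {suc zero ∷ _} (_ ∷ xs≤1) (s≤s len≤sum) = refl ∷ length≤sum⇒all≡1 xs≤1 len≤sum
length≤sum⇒all≡1 {suc (suc _) ∷ _} (s≤s () ∷ _) _

data OneMissing (e₁₂ e₁₃ e₁₄ e₂₃ e₂₄ e₃₄ : ℕ) : Set where
  missing₁₂ : e₁₂ ≡ 0 → e₁₃ ≡ 1 → e₁₄ ≡ 1 → e₂₃ ≡ 1 → e₂₄ ≡ 1 → OneMissing e₁₂ e₁₃ e₁₄ e₂₃ e₂₄ e₃₄
  missing₁₃ : e₁₃ ≡ 0 → e₁₂ ≡ 1 → e₁₄ ≡ 1 → e₂₃ ≡ 1 → e₃₄ ≡ 1 → OneMissing e₁₂ e₁₃ e₁₄ e₂₃ e₂₄ e₃₄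
  missing₁₄ : e₁₄ ≡ 0 → e₁₂ ≡ 1 → e₁₃ ≡ 1 → e₂₄ ≡ 1 → e₃₄ ≡ 1 → OneMissing e₁₂ e₁₃ e₁₄ e₂₃ e₂₄ e₃₄
  missing₂₃ : e₂₃ ≡ 0 → e₁₂ ≡ 1 → e₁₃ ≡ 1 → e₂₄ ≡ 1 → e₃₄ ≡ 1 → OneMissing e₁₂ e₁₃ e₁₄ e₂₃ e₂₄ e₃₄
  missing₂₄ : e₂₄ ≡ 0 → e₁₂ ≡ 1 → e₁₄ ≡ 1 → e₂₃ ≡ 1 → e₃₄ ≡ 1 → OneMissing e₁₂ e₁₃ e₁₄ e₂₃ e₂₄ e₃₄
  missing₃₄ : e₃₄ ≡ 0 → e₁₃ ≡ 1 → e₁₄ ≡ 1 → e₂₃ ≡ 1 → e₂₄ ≡ 1 → OneMissing e₁₂ e₁₃ e₁₄ e₂₃ e₂₄ e₃₄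

sum≡5⇒OneMissing : ∀ e₁₂ e₁₃ e₁₄ e₂₃ e₂₄ e₃₄ → let es = e₁₂ ∷ e₁₃ ∷ e₁₄ ∷ e₂₃ ∷ e₂₄ ∷ e₃₄ ∷ [] in
  All (ℕ._≤ 1) es → sum es ≡ 5 → OneMissing e₁₂ e₁₃ e₁₄ e₂₃ e₂₄ e₃₄
sum≡5⇒OneMissing zero _ _ _ _ _ (_ ∷ bs) s
  with e₁₃ ∷ e₁₄ ∷ e₂₃ ∷ e₂₄ ∷ _ ← length≤sum⇒all≡1 bs (ℕP.≤-reflexive (sym s))
  = missing₁₂ refl e₁₃ e₁₄ e₂₃ e₂₄
sum≡5⇒OneMissing (suc _) zero _ _ _ _ (b₁₂ ∷ _ ∷ bs) s
  with e₁₂ ∷ e₁₄ ∷ e₂₃ ∷ _ ∷ e₃₄ ∷ _ ← length≤sum⇒all≡1 (b₁₂ ∷ bs) (ℕP.≤-reflexive (sym s))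
  = missing₁₃ refl e₁₂ e₁₄ e₂₃ e₃₄
sum≡5⇒OneMissing (suc _) (suc _) zero _ _ _ (b₁₂ ∷ b₁₃ ∷ _ ∷ bs) s
  with e₁₂ ∷ e₁₃ ∷ _ ∷ e₂₄ ∷ e₃₄ ∷ _ ← length≤sum⇒all≡1 (b₁₂ ∷ b₁₃ ∷ bs) (ℕP.≤-reflexive (sym s))
  = missing₁₄ refl e₁₂ e₁₃ e₂₄ e₃₄
sum≡5⇒OneMissing (suc _) (suc _) (suc _) zero _ _ (b₁₂ ∷ b₁₃ ∷ b₁₄ ∷ _ ∷ bs) s
  with e₁₂ ∷ e₁₃ ∷ _ ∷ e₂₄ ∷ e₃₄ ∷ _ ← length≤sum⇒all≡1 (b₁₂ ∷ b₁₃ ∷ b₁₄ ∷ bs) (ℕP.≤-reflexive (sym s))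
  = missing₂₃ refl e₁₂ e₁₃ e₂₄ e₃₄
sum≡5⇒OneMissing (suc _) (suc _) (suc _) (suc _) zero _ (b₁₂ ∷ b₁₃ ∷ b₁₄ ∷ b₂₃ ∷ _ ∷ bs) s
  with e₁₂ ∷ _ ∷ e₁₄ ∷ e₂₃ ∷ e₃₄ ∷ _ ← length≤sum⇒all≡1 (b₁₂ ∷ b₁₃ ∷ b₁₄ ∷ b₂₃ ∷ bs) (ℕP.≤-reflexive (sym s))
  = missing₂₄ refl e₁₂ e₁₄ e₂₃ e₃₄
sum≡5⇒OneMissing (suc _) (suc _) (suc _) (suc _) (suc _) zero (b₁₂ ∷ b₁₃ ∷ b₁₄ ∷ b₂₃ ∷ b₂₄ ∷ _) s
  with _ ∷ e₁₃ ∷ e₁₄ ∷ e₂₃ ∷ e₂₄ ∷ _ ← length≤sum⇒all≡1 (b₁₂ ∷ b₁₃ ∷ b₁₄ ∷ b₂₃ ∷ b₂₄ ∷ []) (ℕP.≤-reflexive (sym s))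
  = missing₃₄ refl e₁₃ e₁₄ e₂₃ e₂₄
sum≡5⇒OneMissing (suc _) (suc _) (suc _) (suc _) (suc _) (suc _)
  (s≤s z≤n ∷ s≤s z≤n ∷ s≤s z≤n ∷ s≤s z≤n ∷ s≤s z≤n ∷ s≤s z≤n ∷ []) ()

sum-map-+ : ∀ {A : Set} (f g : A → ℕ) xs → sum (map (λ x → f x ℕ.+ g x) xs) ≡ sum (map f xs) ℕ.+ sum (map g xs)
sum-map-+ f g [] = refl
sum-map-+ f g (x ∷ xs) = begin
  f x ℕ.+ g x ℕ.+ sum (map (λ x → f x ℕ.+ g x) xs)     ≡⟨ cong (f x ℕ.+ g x ℕ.+_) (sum-map-+ f g xs) ⟩
  f x ℕ.+ g x ℕ.+ (sum (map f xs) ℕ.+ sum (map g xs))  ≡⟨ interchange ℕP.+-commutativeSemigroup (f x) (g x) _ _ ⟩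
  f x ℕ.+ sum (map f xs) ℕ.+ (g x ℕ.+ sum (map g xs))  ∎
  where open ≡-Reasoning

m+m≤2⇒m≤1 : ∀ {m} → m ℕ.+ m ℕ.≤ 2 → m ℕ.≤ 1
m+m≤2⇒m≤1 {m} m+m≤2 = ℕP.*-cancelˡ-≤ 2 (subst (ℕ._≤ 2) (cong (m ℕ.+_) (sym (ℕP.+-identityʳ m))) m+m≤2)

m+n≡2⇒m≡1 : ∀ {m n} → m ℕ.≤ 1 → n ℕ.≤ 1 → m ℕ.+ n ≡ 2 → m ≡ 1
m+n≡2⇒m≡1 z≤n (s≤s ()) refl
m+n≡2⇒m≡1 (s≤s z≤n) _ _ = refl

module Diamonds {V : Set} (u : V → V → ℕ)
  (u-sym : ∀ x y → u x y ≡ u y x) (u-irrefl : ∀ x → u x x ≡ 0) (u≤1 : ∀ x y → u x y ℕ.≤ 1) where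

  deg : V → List V → ℕ
  deg x ys = sum (map (u x) ys)

  edges : List V → ℕ
  edges []       = 0
  edges (x ∷ xs) = deg x xs ℕ.+ edges xs

  deg-flip : ∀ x ys → sum (map (λ y → u y x) ys) ≡ deg x ys
  deg-flip x ys = cong sum (map-cong (λ y → u-sym y x) ys)

  double-counting : ∀ xs ys → sum (map (λ x → deg x ys) xs) ≡ sum (map (λ y → deg y xs) ys)
  double-counting [] ys = sym (deg-nil ys)
    where
    deg-nil : ∀ ys → sum (map (λ y → deg y []) ys) ≡ 0
    deg-nil []       = refl
    deg-nil (_ ∷ ys) = deg-nil ys
  double-counting (x ∷ xs) ys = begin
    deg x ys ℕ.+ sum (map (λ x → deg x ys) xs)                   ≡⟨ cong₂ ℕ._+_ (sym (deg-flip x ys)) (double-counting xs ys) ⟩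
    sum (map (λ y → u y x) ys) ℕ.+ sum (map (λ y → deg y xs) ys)  ≡⟨ sym (sum-map-+ (λ y → u y x) (λ y → deg y xs) ys) ⟩
    sum (map (λ y → deg y (x ∷ xs)) ys)                          ∎
    where open ≡-Reasoning

  handshake : ∀ xs → sum (map (λ x → deg x xs) xs) ≡ 2 ℕ.* edges xs
  handshake [] = refl
  handshake (x ∷ xs) = begin
    u x x ℕ.+ deg x xs ℕ.+ sum (map (λ y → u y x ℕ.+ deg y xs) xs)
      ≡⟨ cong₂ ℕ._+_ (cong (ℕ._+ deg x xs) (u-irrefl x)) (sum-map-+ (λ y → u y x) (λ y → deg y xs) xs) ⟩
    deg x xs ℕ.+ (sum (map (λ y → u y x) xs) ℕ.+ sum (map (λ y → deg y xs) xs))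
      ≡⟨ cong (deg x xs ℕ.+_) (cong₂ ℕ._+_ (deg-flip x xs) (handshake xs)) ⟩
    deg x xs ℕ.+ (deg x xs ℕ.+ 2 ℕ.* edges xs)
      ≡⟨ arith (deg x xs) (edges xs) ⟩
    2 ℕ.* edges (x ∷ xs) ∎
    where
    open ≡-Reasoning
    arith : ∀ d e → d ℕ.+ (d ℕ.+ 2 ℕ.* e) ≡ 2 ℕ.* (d ℕ.+ e)
    arith = solve-∀

  u-flip : ∀ {x y} → u x y ≡ 1 → u y x ≡ 1
  u-flip {x} {y} = trans (u-sym y x)

  data Diamond (P : V → Set) : Set where
    diamond : ∀ {r₁ r₂ s₁ s₂} → All P (r₁ ∷ r₂ ∷ s₁ ∷ s₂ ∷ []) → r₁ ≢ r₂ → s₁ ≢ s₂ → u r₁ r₂ ≡ 0 →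
              u r₁ s₁ ≡ 1 → u r₁ s₂ ≡ 1 → u r₂ s₁ ≡ 1 → u r₂ s₂ ≡ 1 → Diamond P

  OneMissing⇒Diamond : ∀ {P p₁ p₂ p₃ p₄} → All P (p₁ ∷ p₂ ∷ p₃ ∷ p₄ ∷ []) → AllPairs _≢_ (p₁ ∷ p₂ ∷ p₃ ∷ p₄ ∷ []) →
    OneMissing (u p₁ p₂) (u p₁ p₃) (u p₁ p₄) (u p₂ p₃) (u p₂ p₄) (u p₃ p₄) → Diamond P
  OneMissing⇒Diamond (P₁ ∷ P₂ ∷ P₃ ∷ P₄ ∷ [])
    ((p₁≢p₂ ∷ p₁≢p₃ ∷ p₁≢p₄ ∷ []) ∷ (p₂≢p₃ ∷ p₂≢p₄ ∷ []) ∷ (p₃≢p₄ ∷ []) ∷ [] ∷ []) = λ where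
    (missing₁₂ e₁₂ e₁₃ e₁₄ e₂₃ e₂₄) → diamond (P₁ ∷ P₂ ∷ P₃ ∷ P₄ ∷ []) p₁≢p₂ p₃≢p₄ e₁₂ e₁₃ e₁₄ e₂₃ e₂₄
    (missing₁₃ e₁₃ e₁₂ e₁₄ e₂₃ e₃₄) → diamond (P₁ ∷ P₃ ∷ P₂ ∷ P₄ ∷ []) p₁≢p₃ p₂≢p₄ e₁₃ e₁₂ e₁₄ (u-flip e₂₃) e₃₄
    (missing₁₄ e₁₄ e₁₂ e₁₃ e₂₄ e₃₄) → diamond (P₁ ∷ P₄ ∷ P₂ ∷ P₃ ∷ []) p₁≢p₄ p₂≢p₃ e₁₄ e₁₂ e₁₃ (u-flip e₂₄) (u-flip e₃₄)
    (missing₂₃ e₂₃ e₁₂ e₁₃ e₂₄ e₃₄) → diamond (P₂ ∷ P₃ ∷ P₁ ∷ P₄ ∷ []) p₂≢p₃ p₁≢p₄ e₂₃ (u-flip e₁₂) e₂₄ (u-flip e₁₃) e₃₄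
    (missing₂₄ e₂₄ e₁₂ e₁₄ e₂₃ e₃₄) → diamond (P₂ ∷ P₄ ∷ P₁ ∷ P₃ ∷ []) p₂≢p₄ p₁≢p₃ e₂₄ (u-flip e₁₂) e₂₃ (u-flip e₁₄) (u-flip e₃₄)
    (missing₃₄ e₃₄ e₁₃ e₁₄ e₂₃ e₂₄) → diamond (P₃ ∷ P₄ ∷ P₁ ∷ P₂ ∷ []) p₃≢p₄ p₁≢p₂ e₃₄ (u-flip e₁₃) (u-flip e₂₃) (u-flip e₁₄) (u-flip e₂₄)

  degrees⇒diamond : ∀ {P} ps qs → length ps ≡ 4 → length qs ≡ 2 → All P ps → AllPairs _≢_ ps →
    All (λ p → deg p ps ℕ.+ deg p qs ≡ 3) ps → All (λ q → deg q ps ℕ.+ deg q qs ≡ 2) qs →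
    All (λ q → deg q ps ℕ.≤ 1) qs → Diamond P
  degrees⇒diamond ps@(p₁ ∷ p₂ ∷ p₃ ∷ p₄ ∷ []) qs@(q₁ ∷ q₂ ∷ []) refl refl P-ps distinct
    deg-ps (deg-q₁ ∷ deg-q₂ ∷ []) (q₁≤1 ∷ q₂≤1 ∷ []) =
    OneMissing⇒Diamond P-ps distinct (sum≡5⇒OneMissing _ _ _ _ _ _ (u≤1 _ _ ∷ u≤1 _ _ ∷ u≤1 _ _ ∷ u≤1 _ _ ∷ u≤1 _ _ ∷ u≤1 _ _ ∷ []) edges≡5)
    where
    q₁-sees-one : deg q₁ ps ≡ 1
    q₁-sees-one = m+n≡2⇒m≡1 q₁≤1 q₁-in-qs deg-q₁
      where
      q₁-in-qs : deg q₁ qs ℕ.≤ 1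
      q₁-in-qs = ℕP.+-mono-≤ (ℕP.≤-reflexive (u-irrefl q₁)) (ℕP.+-mono-≤ (u≤1 q₁ q₂) z≤n)
    q₂-sees-one : deg q₂ ps ≡ 1
    q₂-sees-one = m+n≡2⇒m≡1 q₂≤1 q₂-in-qs deg-q₂
      where
      q₂-in-qs : deg q₂ qs ℕ.≤ 1
      q₂-in-qs = ℕP.+-mono-≤ (u≤1 q₂ q₁) (ℕP.+-mono-≤ (ℕP.≤-reflexive (u-irrefl q₂)) z≤n)
    twice-edges : 2 ℕ.* edges ps ℕ.+ 2 ≡ 12
    twice-edges = begin
      2 ℕ.* edges ps ℕ.+ 2                                           ≡⟨ cong₂ ℕ._+_ (handshake ps) (cong₂ ℕ._+_ q₁-sees-one (cong (ℕ._+ 0) q₂-sees-one)) ⟨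
      sum (map (λ p → deg p ps) ps) ℕ.+ (deg q₁ ps ℕ.+ (deg q₂ ps ℕ.+ 0)) ≡⟨ cong (sum (map (λ p → deg p ps) ps) ℕ.+_) (double-counting ps qs) ⟨
      sum (map (λ p → deg p ps) ps) ℕ.+ sum (map (λ p → deg p qs) ps) ≡⟨ sum-map-+ (λ p → deg p ps) (λ p → deg p qs) ps ⟨
      sum (map (λ p → deg p ps ℕ.+ deg p qs) ps)                     ≡⟨ cong sum (map-cong-local deg-ps) ⟩
      12                                                               ∎
      where open ≡-Reasoning
    edges≡5 : sum (u p₁ p₂ ∷ u p₁ p₃ ∷ u p₁ p₄ ∷ u p₂ p₃ ∷ u p₂ p₄ ∷ u p₃ p₄ ∷ []) ≡ 5
    edges≡5 = trans (regroup (u p₁ p₂) (u p₁ p₃) (u p₁ p₄) (u p₂ p₃) (u p₂ p₄) (u p₃ p₄))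
      (ℕP.*-cancelˡ-≡ (edges ps) 5 2 (ℕP.+-cancelʳ-≡ 2 (2 ℕ.* edges ps) 10 twice-edges))
      where
      regroup : ∀ a b c d e f → a ℕ.+ (b ℕ.+ (c ℕ.+ (d ℕ.+ (e ℕ.+ (f ℕ.+ 0))))) ≡
                                (a ℕ.+ (b ℕ.+ (c ℕ.+ 0))) ℕ.+ ((d ℕ.+ (e ℕ.+ 0)) ℕ.+ ((f ℕ.+ 0) ℕ.+ 0))
      regroup = solve-∀

∑≡sum : ∀ n (f : Fin n → ℤ) → ∑ n f ≡ FinSum.sum f
∑≡sum zero    f = refl
∑≡sum (suc n) f = cong (_+_ (f zero)) (∑≡sum n (f ∘ suc))

∑-cong : ∀ n {f g : Fin n → ℤ} → (∀ k → f k ≡ g k) → ∑ n f ≡ ∑ n g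
∑-cong zero    f≗g = refl
∑-cong (suc n) f≗g = cong₂ _+_ (f≗g zero) (∑-cong n (f≗g ∘ suc))

∑-distrib-+ : ∀ n (f g : Fin n → ℤ) → ∑ n (λ k → f k + g k) ≡ ∑ n f + ∑ n g
∑-distrib-+ n f g rewrite ∑≡sum n f | ∑≡sum n g | ∑≡sum n (λ k → f k + g k) = FinSum.∑-distrib-+ f g

∑-comm : ∀ n (f : Fin n → Fin n → ℤ) → ∑ n (λ i → ∑ n (f i)) ≡ ∑ n (λ j → ∑ n (λ i → f i j))
∑-comm n f = begin
  ∑ n (λ i → ∑ n (f i))                          ≡⟨ ∑-cong n (λ i → ∑≡sum n (f i)) ⟩
  ∑ n (λ i → FinSum.sum (f i))                   ≡⟨ ∑≡sum n _ ⟩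
  FinSum.sum (λ i → FinSum.sum (f i))            ≡⟨ FinSum.∑-comm f ⟩
  FinSum.sum (λ j → FinSum.sum (λ i → f i j))    ≡⟨ ∑≡sum n _ ⟨
  ∑ n (λ j → FinSum.sum (λ i → f i j))           ≡⟨ ∑-cong n (λ j → ∑≡sum n (λ i → f i j)) ⟨
  ∑ n (λ j → ∑ n (λ i → f i j))                  ∎
  where open ≡-Reasoning

*-distribˡ-∑ : ∀ n x (f : Fin n → ℤ) → x * ∑ n f ≡ ∑ n (λ k → x * f k)
*-distribˡ-∑ n x f rewrite ∑≡sum n f | ∑≡sum n (λ k → x * f k) = FinSum.*-distribˡ-sum x f

∑-neg : ∀ n (f : Fin n → ℤ) → ∑ n (λ k → - f k) ≡ - ∑ n f
∑-neg n f = begin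
  ∑ n (λ k → - f k)        ≡⟨ ∑-cong n (λ k → ℤP.-1*i≡-i (f k)) ⟨
  ∑ n (λ k → - + 1 * f k)  ≡⟨ *-distribˡ-∑ n (- + 1) f ⟨
  - + 1 * ∑ n f            ≡⟨ ℤP.-1*i≡-i (∑ n f) ⟩
  - ∑ n f                  ∎
  where open ≡-Reasoning

∑-mono-≤ : ∀ n {f g : Fin n → ℤ} → (∀ k → f k ≤ g k) → ∑ n f ≤ ∑ n g
∑-mono-≤ zero    f≤g = ℤP.≤-refl
∑-mono-≤ (suc n) f≤g = ℤP.+-mono-≤ (f≤g zero) (∑-mono-≤ n (f≤g ∘ suc))

∑-nonneg : ∀ n {f : Fin n → ℤ} → (∀ k → + 0 ≤ f k) → + 0 ≤ ∑ n f
∑-nonneg zero    f≥0 = ℤP.≤-refl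
∑-nonneg (suc n) f≥0 = ℤP.+-mono-≤ (f≥0 zero) (∑-nonneg n (f≥0 ∘ suc))

∑-split-at : ∀ n (f : Fin n → ℤ) x → ∑ n f ≡ f x + ∑ n (updateAt f x (const (+ 0)))
∑-split-at (suc n) f zero    = cong (_+_ (f zero)) (sym (ℤP.+-identityˡ _))
∑-split-at (suc n) f (suc x) = begin
  f zero + ∑ n (f ∘ suc)       ≡⟨ cong (_+_ (f zero)) (∑-split-at n (f ∘ suc) x) ⟩
  f zero + (f (suc x) + rest)  ≡⟨ x∙yz≈y∙xz ℤP.+-commutativeSemigroup (f zero) (f (suc x)) rest ⟩
  f (suc x) + (f zero + rest)  ∎
  where
  open ≡-Reasoning
  rest = ∑ n (updateAt (f ∘ suc) x (const (+ 0)))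

sumᶻ : List ℤ → ℤ
sumᶻ = foldr _+_ (+ 0)

sumᶻ-map-+ : ∀ {A : Set} (f : A → ℕ) xs → sumᶻ (map (λ x → + f x) xs) ≡ + sum (map f xs)
sumᶻ-map-+ f [] = refl
sumᶻ-map-+ f (x ∷ xs) = trans (cong (_+_ (+ f x)) (sumᶻ-map-+ f xs)) (sym (ℤP.pos-+ (f x) _))

sumᶻ-ones : ∀ {A : Set} (xs : List A) → sumᶻ (map (const (+ 1)) xs) ≡ + length xs
sumᶻ-ones []       = refl
sumᶻ-ones (_ ∷ xs) = trans (cong (_+_ (+ 1)) (sumᶻ-ones xs)) (sym (ℤP.pos-+ 1 (length xs)))


sumᶻ-distinct≤∑ : ∀ n (f : Fin n → ℤ) → (∀ k → + 0 ≤ f k) → ∀ {xs} → AllPairs _≢_ xs → sumᶻ (map f xs) ≤ ∑ n f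
sumᶻ-distinct≤∑ n f f≥0 [] = ∑-nonneg n f≥0
sumᶻ-distinct≤∑ n f f≥0 {x ∷ xs} (x∉xs ∷ distinct) = begin
  f x + sumᶻ (map f xs)  ≡⟨ cong (λ ys → f x + sumᶻ ys) (map-cong-local (All.map f≗f′ x∉xs)) ⟩
  f x + sumᶻ (map f′ xs) ≤⟨ ℤP.+-monoʳ-≤ (f x) (sumᶻ-distinct≤∑ n f′ f′≥0 distinct) ⟩
  f x + ∑ n f′           ≡⟨ ∑-split-at n f x ⟨
  ∑ n f                  ∎
  where
  open ℤP.≤-Reasoning
  f′ = updateAt f x (const (+ 0))
  f′≥0 : ∀ k → + 0 ≤ f′ k
  f′≥0 k with k Fin.≟ x
  ... | yes refl = ℤP.≤-reflexive (sym (updateAt-updates x f))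
  ... | no k≢x   = subst (+ 0 ≤_) (sym (updateAt-minimal k x f k≢x)) (f≥0 k)
  f≗f′ : ∀ {y} → x ≢ y → f y ≡ f′ y
  f≗f′ {y} x≢y = sym (updateAt-minimal y x f (x≢y ∘ sym))

𝟙 : ∀ {P : Set} → Dec P → ℤ
𝟙 P? = if does P? then + 1 else + 0

∑-filter : ∀ {A : Set} {P : Pred A _} (P? : Decidable P) n (h : Fin n → A) (g : A → ℤ) →
  ∑ n (λ k → 𝟙 (P? (h k)) * g (h k)) ≡ sumᶻ (map g (filter P? (tabulate h)))
∑-filter P? zero    h g = refl
∑-filter P? (suc n) h g with does (P? (h zero))
... | true  = cong₂ _+_ (ℤP.*-identityˡ (g (h zero))) (∑-filter P? n (h ∘ suc) g)
... | false = trans (ℤP.+-identityˡ _) (∑-filter P? n (h ∘ suc) g)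

Entry : ℤ → Set
Entry x = (x ≡ + 0) ⊎ (x ≡ + 1) ⊎ (x ≡ - (+ 1))

Sign : ℤ → Set
Sign x = (x ≡ + 1) ⊎ (x ≡ - (+ 1))

sign-triangle : ∀ {x y z} → Sign x → Sign y → Sign z → x * y * z ≡ + 1 → y ≡ x * z
sign-triangle (inj₁ refl) (inj₁ refl) (inj₁ refl) _  = refl
sign-triangle (inj₁ refl) (inj₁ refl) (inj₂ refl) ()
sign-triangle (inj₁ refl) (inj₂ refl) (inj₁ refl) ()
sign-triangle (inj₁ refl) (inj₂ refl) (inj₂ refl) _  = refl
sign-triangle (inj₂ refl) (inj₁ refl) (inj₁ refl) ()
sign-triangle (inj₂ refl) (inj₁ refl) (inj₂ refl) _  = refl
sign-triangle (inj₂ refl) (inj₂ refl) (inj₁ refl) _  = refl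
sign-triangle (inj₂ refl) (inj₂ refl) (inj₂ refl) ()

sign≢0 : ∀ {x} → Sign x → x ≢ + 0
sign≢0 (inj₁ refl) ()
sign≢0 (inj₂ refl) ()

∣sign∣≡1 : ∀ {x} → Sign x → ∣ x ∣ ≡ 1
∣sign∣≡1 (inj₁ refl) = refl
∣sign∣≡1 (inj₂ refl) = refl

four-and-two : ∀ p q → + p + + q ≡ + 6 → + p - + q ≡ + 2 → p ≡ 4 × q ≡ 2
four-and-two 0 _ refl ()
four-and-two 1 _ refl ()
four-and-two 2 _ refl ()
four-and-two 3 _ refl ()
four-and-two 4 _ refl refl = refl , refl
four-and-two 5 _ refl ()
four-and-two 6 _ refl ()

i*j+∣i∣≥0 : ∀ {i j} → Entry i → Entry j → + 0 ≤ i * j + + ∣ i ∣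
i*j+∣i∣≥0 (inj₁ refl)        _                  = +≤+ z≤n
i*j+∣i∣≥0 (inj₂ (inj₁ refl)) (inj₁ refl)        = +≤+ z≤n
i*j+∣i∣≥0 (inj₂ (inj₁ refl)) (inj₂ (inj₁ refl)) = +≤+ z≤n
i*j+∣i∣≥0 (inj₂ (inj₁ refl)) (inj₂ (inj₂ refl)) = +≤+ z≤n
i*j+∣i∣≥0 (inj₂ (inj₂ refl)) (inj₁ refl)        = +≤+ z≤n
i*j+∣i∣≥0 (inj₂ (inj₂ refl)) (inj₂ (inj₁ refl)) = +≤+ z≤n
i*j+∣i∣≥0 (inj₂ (inj₂ refl)) (inj₂ (inj₂ refl)) = +≤+ z≤n

∣i∣-i≥0 : ∀ {i} → Entry i → + 0 ≤ + ∣ i ∣ - i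
∣i∣-i≥0 (inj₁ refl)        = +≤+ z≤n
∣i∣-i≥0 (inj₂ (inj₁ refl)) = +≤+ z≤n
∣i∣-i≥0 (inj₂ (inj₂ refl)) = +≤+ z≤n

module SignedGraphProperties {n : ℕ} (G : SignedGraph n) where

  U : Fin n → Fin n → ℕ
  U i j = ∣ A G i j ∣

  U-sym : ∀ i j → U i j ≡ U j i
  U-sym i j = cong ∣_∣ (symm G i j)

  U-irrefl : ∀ i → U i i ≡ 0
  U-irrefl i = cong ∣_∣ (noLoop G i)

  U≤1 : ∀ i j → U i j ℕ.≤ 1
  U≤1 i j with entry G i j
  ... | inj₁ e        rewrite e = z≤n
  ... | inj₂ (inj₁ e) rewrite e = s≤s z≤n
  ... | inj₂ (inj₂ e) rewrite e = s≤s z≤n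

  adj-sym : ∀ {i j} → Adj G i j → Adj G j i
  adj-sym {i} {j} i~j = i~j ∘ trans (symm G i j)

  adj⇒sign : ∀ {i j} → Adj G i j → Sign (A G i j)
  adj⇒sign {i} {j} i~j with entry G i j
  ... | inj₁ e    = ⊥-elim (i~j e)
  ... | inj₂ sign = sign

  adj⇒≢ : ∀ {i j} → Adj G i j → i ≢ j
  adj⇒≢ {i} i~i refl = i~i (noLoop G i)

  U≡1⇒adj : ∀ {i j} → U i j ≡ 1 → Adj G i j
  U≡1⇒adj U≡1 A≡0 = ℕP.0≢1+n (trans (sym (cong ∣_∣ A≡0)) U≡1)

  U≡0⇒¬adj : ∀ {i j} → U i j ≡ 0 → ¬ Adj G i j
  U≡0⇒¬adj U≡0 i~j = i~j (ℤP.∣i∣≡0⇒i≡0 U≡0)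

  codegree : Fin n → Fin n → ℤ
  codegree i j = ∑ n (λ k → + U i k * + U k j)

  module Balanced (balanced : AllTrianglesBalanced G) where

    edge-sign : ∀ {v x y} → Adj G v x → Adj G v y → Adj G x y → A G x y ≡ A G v x * A G v y
    edge-sign {v} {x} {y} v~x v~y x~y =
      sign-triangle (adj⇒sign v~x) (adj⇒sign x~y) (adj⇒sign v~y)
        (subst (λ z → A G v x * A G x y * z ≡ + 1) (symm G y v) (balanced v x y v~x x~y (adj-sym v~y)))

    two-path : ∀ {i j} → Adj G i j → ∀ k → A G i k * A G k j ≡ A G i j * (+ ∣ A G i k ∣ * + ∣ A G k j ∣)
    two-path {i} {j} i~j k with entry G i k | entry G k j
    ... | inj₁ i≁k | _ rewrite i≁k = sym (ℤP.*-zeroʳ (A G i j))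
    ... | inj₂ (inj₁ i-k) | inj₁ k≁j rewrite i-k | k≁j = sym (ℤP.*-zeroʳ (A G i j))
    ... | inj₂ (inj₂ i-k) | inj₁ k≁j rewrite i-k | k≁j = sym (ℤP.*-zeroʳ (A G i j))
    ... | inj₂ i-k | inj₂ k-j = begin
      A G i k * A G k j                                ≡⟨ cong (_* A G k j) (symm G i k) ⟩
      A G k i * A G k j                                ≡⟨ edge-sign k~i (sign≢0 k-j) i~j ⟨
      A G i j                                          ≡⟨ ℤP.*-identityʳ (A G i j) ⟨
      A G i j * + 1                                    ≡⟨ cong₂ (λ a b → A G i j * (+ a * + b)) (∣sign∣≡1 i-k) (∣sign∣≡1 k-j) ⟨
      A G i j * (+ ∣ A G i k ∣ * + ∣ A G k j ∣)        ∎
      where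
      open ≡-Reasoning
      k~i : Adj G k i
      k~i = adj-sym (sign≢0 i-k)

    A²-adj : ∀ {i j} → Adj G i j → A² G i j ≡ A G i j * codegree i j
    A²-adj {i} {j} i~j = trans (∑-cong n (two-path i~j)) (sym (*-distribˡ-∑ n (A G i j) _))

  ∑-A² : ∀ {ρ} → NetRegular G ρ → ∀ i → ∑ n (A² G i) ≡ ρ * ρ
  ∑-A² {ρ} net i = begin
    ∑ n (λ j → ∑ n (λ k → A G i k * A G k j))    ≡⟨ ∑-comm n (λ j k → A G i k * A G k j) ⟩
    ∑ n (λ k → ∑ n (λ j → A G i k * A G k j))    ≡⟨ ∑-cong n (λ k → sym (*-distribˡ-∑ n (A G i k) (A G k))) ⟩
    ∑ n (λ k → A G i k * netDegree G k)          ≡⟨ ∑-cong n (λ k → trans (cong (A G i k *_) (net k)) (ℤP.*-comm (A G i k) ρ)) ⟩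
    ∑ n (λ k → ρ * A G i k)                      ≡⟨ *-distribˡ-∑ n ρ (A G i) ⟨
    ρ * netDegree G i                            ≡⟨ cong (ρ *_) (net i) ⟩
    ρ * ρ                                        ∎
    where open ≡-Reasoning

  positives negatives : Fin n → List (Fin n)
  positives v = filter (λ k → A G v k ≟ + 1) (allFin n)
  negatives v = filter (λ k → A G v k ≟ - (+ 1)) (allFin n)

  positives-unique : ∀ v → Unique (positives v)
  positives-unique v = filter⁺ _ (allFin⁺ n)

  positives-positive : ∀ v → All (λ k → A G v k ≡ + 1) (positives v)
  positives-positive v = all-filter _ (allFin n)

  negatives-negative : ∀ v → All (λ k → A G v k ≡ - (+ 1)) (negatives v)
  negatives-negative v = all-filter _ (allFin n)

  𝟙⁺ 𝟙⁻ : Fin n → Fin n → ℤ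
  𝟙⁺ v k = 𝟙 (A G v k ≟ + 1)
  𝟙⁻ v k = 𝟙 (A G v k ≟ - (+ 1))

  ∣A∣≡𝟙⁺+𝟙⁻ : ∀ v k → + U v k ≡ 𝟙⁺ v k + 𝟙⁻ v k
  ∣A∣≡𝟙⁺+𝟙⁻ v k with entry G v k
  ... | inj₁ e        rewrite e = refl
  ... | inj₂ (inj₁ e) rewrite e = refl
  ... | inj₂ (inj₂ e) rewrite e = refl

  A≡𝟙⁺-𝟙⁻ : ∀ v k → A G v k ≡ 𝟙⁺ v k - 𝟙⁻ v k
  A≡𝟙⁺-𝟙⁻ v k with entry G v k
  ... | inj₁ e        rewrite e = refl
  ... | inj₂ (inj₁ e) rewrite e = refl
  ... | inj₂ (inj₂ e) rewrite e = refl

  ∑-𝟙⁺ : ∀ v (g : Fin n → ℤ) → ∑ n (λ k → 𝟙⁺ v k * g k) ≡ sumᶻ (map g (positives v))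
  ∑-𝟙⁺ v g = ∑-filter (λ k → A G v k ≟ + 1) n (λ k → k) g

  ∑-𝟙⁻ : ∀ v (g : Fin n → ℤ) → ∑ n (λ k → 𝟙⁻ v k * g k) ≡ sumᶻ (map g (negatives v))
  ∑-𝟙⁻ v g = ∑-filter (λ k → A G v k ≟ - (+ 1)) n (λ k → k) g

  ∑-∣A∣-split : ∀ v (g : Fin n → ℤ) →
    ∑ n (λ k → + U v k * g k) ≡ sumᶻ (map g (positives v)) + sumᶻ (map g (negatives v))
  ∑-∣A∣-split v g = begin
    ∑ n (λ k → + U v k * g k)                               ≡⟨ ∑-cong n (λ k → trans (cong (_* g k) (∣A∣≡𝟙⁺+𝟙⁻ v k)) (ℤP.*-distribʳ-+ (g k) (𝟙⁺ v k) (𝟙⁻ v k))) ⟩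
    ∑ n (λ k → 𝟙⁺ v k * g k + 𝟙⁻ v k * g k)                 ≡⟨ ∑-distrib-+ n _ _ ⟩
    ∑ n (λ k → 𝟙⁺ v k * g k) + ∑ n (λ k → 𝟙⁻ v k * g k)     ≡⟨ cong₂ _+_ (∑-𝟙⁺ v g) (∑-𝟙⁻ v g) ⟩
    sumᶻ (map g (positives v)) + sumᶻ (map g (negatives v)) ∎
    where open ≡-Reasoning

  ∑-A-split : ∀ v (g : Fin n → ℤ) →
    ∑ n (λ k → A G v k * g k) ≡ sumᶻ (map g (positives v)) - sumᶻ (map g (negatives v))
  ∑-A-split v g = begin
    ∑ n (λ k → A G v k * g k)                               ≡⟨ ∑-cong n (λ k → trans (cong (_* g k) (A≡𝟙⁺-𝟙⁻ v k)) (*-distribʳ-- (𝟙⁺ v k) (𝟙⁻ v k) (g k))) ⟩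
    ∑ n (λ k → 𝟙⁺ v k * g k + - (𝟙⁻ v k * g k))             ≡⟨ ∑-distrib-+ n _ _ ⟩
    ∑ n (λ k → 𝟙⁺ v k * g k) + ∑ n (λ k → - (𝟙⁻ v k * g k)) ≡⟨ cong (_+_ (∑ n (λ k → 𝟙⁺ v k * g k))) (∑-neg n _) ⟩
    ∑ n (λ k → 𝟙⁺ v k * g k) - ∑ n (λ k → 𝟙⁻ v k * g k)     ≡⟨ cong₂ _-_ (∑-𝟙⁺ v g) (∑-𝟙⁻ v g) ⟩
    sumᶻ (map g (positives v)) - sumᶻ (map g (negatives v)) ∎
    where
    open ≡-Reasoning
    *-distribʳ-- : ∀ a b x → (a - b) * x ≡ a * x + - (b * x)
    *-distribʳ-- a b x = trans (ℤP.*-distribʳ-+ x a (- b)) (cong (_+_ (a * x)) (sym (ℤP.neg-distribˡ-* b x)))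

  degree-split : ∀ v → degree G v ≡ + length (positives v) + + length (negatives v)
  degree-split v = trans (∑-cong n (λ k → sym (ℤP.*-identityʳ (+ U v k))))
    (trans (∑-∣A∣-split v (const (+ 1))) (cong₂ _+_ (sumᶻ-ones (positives v)) (sumᶻ-ones (negatives v))))

  netDegree-split : ∀ v → netDegree G v ≡ + length (positives v) - + length (negatives v)
  netDegree-split v = trans (∑-cong n (λ k → sym (ℤP.*-identityʳ (A G v k))))
    (trans (∑-A-split v (const (+ 1))) (cong₂ _-_ (sumᶻ-ones (positives v)) (sumᶻ-ones (negatives v))))

module Counterexample {n : ℕ} (G : SignedGraph n) (c : ℤ)
  (regular : Regular G 6) (net-regular : NetRegular G (+ 2)) (balanced : AllTrianglesBalanced G)
  (diagonal : ∀ i → A² G i i ≡ + 6)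
  (positive-edge : ∀ i j → PosEdge G i j → A² G i j ≡ + 3)
  (negative-edge : ∀ i j → NegEdge G i j → A² G i j ≡ - (+ 2))
  (non-edge : ∀ i j → i ≢ j → ¬ Adj G i j → A² G i j ≡ c) where

  open SignedGraphProperties G
  open Balanced balanced
  open Diamonds U U-sym U-irrefl U≤1

  four-positive-two-negative : ∀ v → length (positives v) ≡ 4 × length (negatives v) ≡ 2
  four-positive-two-negative v = four-and-two _ _
    (trans (sym (degree-split v)) (regular v)) (trans (sym (netDegree-split v)) (net-regular v))

  codegree-split : ∀ v j → codegree v j ≡ + (deg j (positives v) ℕ.+ deg j (negatives v))
  codegree-split v j = begin
    codegree v j                                                  ≡⟨ ∑-∣A∣-split v (λ k → + U k j) ⟩
    sumᶻ (map (λ k → + U k j) P) + sumᶻ (map (λ k → + U k j) N)   ≡⟨ cong₂ _+_ (sumᶻ-map-+ (λ k → U k j) P) (sumᶻ-map-+ (λ k → U k j) N) ⟩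
    + sum (map (λ k → U k j) P) + + sum (map (λ k → U k j) N)     ≡⟨ cong₂ (λ a b → + a + + b) (deg-flip j P) (deg-flip j N) ⟩
    + deg j P + + deg j N                                          ≡⟨ ℤP.pos-+ (deg j P) (deg j N) ⟨
    + (deg j P ℕ.+ deg j N)                                        ∎
    where
    open ≡-Reasoning
    P N : List (Fin n)
    P = positives v
    N = negatives v

  codegree-positive : ∀ {v p} → A G v p ≡ + 1 → deg p (positives v) ℕ.+ deg p (negatives v) ≡ 3
  codegree-positive {v} {p} v-p = ℤP.+-injective (begin
    + (deg p (positives v) ℕ.+ deg p (negatives v)) ≡⟨ codegree-split v p ⟨
    codegree v p                                     ≡⟨ ℤP.*-identityˡ (codegree v p) ⟨
    + 1 * codegree v p                               ≡⟨ cong (_* codegree v p) v-p ⟨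
    A G v p * codegree v p                           ≡⟨ A²-adj (sign≢0 (inj₁ v-p)) ⟨
    A² G v p                                         ≡⟨ positive-edge v p v-p ⟩
    + 3                                              ∎)
    where open ≡-Reasoning

  codegree-negative : ∀ {v q} → A G v q ≡ - (+ 1) → deg q (positives v) ℕ.+ deg q (negatives v) ≡ 2
  codegree-negative {v} {q} v-q = ℤP.+-injective (ℤP.neg-injective (begin
    - + (deg q (positives v) ℕ.+ deg q (negatives v)) ≡⟨ cong -_ (codegree-split v q) ⟨
    - codegree v q                                     ≡⟨ ℤP.-1*i≡-i (codegree v q) ⟨
    - + 1 * codegree v q                               ≡⟨ cong (_* codegree v q) v-q ⟨
    A G v q * codegree v q                             ≡⟨ A²-adj (sign≢0 (inj₂ v-q)) ⟨
    A² G v q                                           ≡⟨ negative-edge v q v-q ⟩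
    - + 2                                              ∎))
    where open ≡-Reasoning

  positives-exclude-self : ∀ v → AllPairs _≢_ (v ∷ positives v)
  positives-exclude-self v = All.map (λ v-x → adj⇒≢ (sign≢0 (inj₁ v-x))) (positives-positive v) ∷ positives-unique v

  negative-meets-one-positive : ∀ {v q} → A G v q ≡ - (+ 1) → deg q (positives v) ℕ.≤ 1
  negative-meets-one-positive {v} {q} v-q = m+m≤2⇒m≤1 (ℕP.+-cancelˡ-≤ 2 (d ℕ.+ d) 2 (ℤP.drop‿+≤+ weight-bound))
    where
    d : ℕ
    d = deg q (positives v)
    -- f k is 2 if qk is a negative edge and 0 otherwise; v and the neighbours of q in P are such k.
    f : Fin n → ℤ
    f k = + U q k - A G q k
    f-at-v : f v ≡ + 2
    f-at-v rewrite symm G q v | v-q = refl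
    f-at-positive : ∀ {p} → A G v p ≡ + 1 → f p ≡ + (U q p ℕ.+ U q p)
    f-at-positive {p} v-p with entry G q p
    ... | inj₁ e        rewrite e = refl
    ... | inj₂ (inj₂ e) rewrite e = refl
    ... | inj₂ (inj₁ e) = ⊥-elim (from-no (+ 1 ℤ.≟ - (+ 1))
      (trans (sym e) (trans (edge-sign (sign≢0 (inj₂ v-q)) (sign≢0 (inj₁ v-p)) (sign≢0 (inj₁ e))) (cong₂ _*_ v-q v-p))))
    weight-on-list : sumᶻ (map f (v ∷ positives v)) ≡ + (2 ℕ.+ (d ℕ.+ d))
    weight-on-list = begin
      f v + sumᶻ (map f (positives v))                            ≡⟨ cong₂ _+_ f-at-v (cong sumᶻ (map-cong-local (All.map f-at-positive (positives-positive v)))) ⟩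
      + 2 + sumᶻ (map (λ p → + (U q p ℕ.+ U q p)) (positives v))  ≡⟨ cong (_+_ (+ 2)) (sumᶻ-map-+ (λ p → U q p ℕ.+ U q p) (positives v)) ⟩
      + 2 + + sum (map (λ p → U q p ℕ.+ U q p) (positives v))     ≡⟨ cong (λ m → + 2 + + m) (sum-map-+ (U q) (U q) (positives v)) ⟩
      + (2 ℕ.+ (d ℕ.+ d))                                          ∎
      where open ≡-Reasoning
    total-weight : ∑ n f ≡ + 4
    total-weight = begin
      ∑ n (λ k → + U q k + - A G q k)    ≡⟨ ∑-distrib-+ n _ _ ⟩
      degree G q + ∑ n (λ k → - A G q k) ≡⟨ cong₂ _+_ (regular q) (trans (∑-neg n (A G q)) (cong -_ (net-regular q))) ⟩
      + 4                                ∎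
      where open ≡-Reasoning
    weight-bound : + (2 ℕ.+ (d ℕ.+ d)) ≤ + 4
    weight-bound = subst₂ _≤_ weight-on-list total-weight
      (sumᶻ-distinct≤∑ n f (λ k → ∣i∣-i≥0 (entry G q k)) (positives-exclude-self v))

  positive-diamond : ∀ v → Diamond (λ x → A G v x ≡ + 1)
  positive-diamond v = degrees⇒diamond (positives v) (negatives v) |P|≡4 |N|≡2
    (positives-positive v) (positives-unique v)
    (All.map codegree-positive (positives-positive v))
    (All.map codegree-negative (negatives-negative v))
    (All.map negative-meets-one-positive (negatives-negative v))
    where
    |P|≡4 = proj₁ (four-positive-two-negative v)
    |N|≡2 = proj₂ (four-positive-two-negative v)

  diamond⇒c≥0 : ∀ {v} → Diamond (λ x → A G v x ≡ + 1) → + 0 ≤ c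
  diamond⇒c≥0 {v} (diamond {r₁} {r₂} {s₁} {s₂} (v-r₁ ∷ v-r₂ ∷ v-s₁ ∷ v-s₂ ∷ []) r₁≢r₂ s₁≢s₂ r₁≁r₂ r₁-s₁ r₁-s₂ r₂-s₁ r₂-s₂) =
    subst (+ 0 ≤_) (trans (ℤP.+-assoc c (+ 6) (- + 6)) (ℤP.+-identityʳ c))
      (ℤP.+-monoˡ-≤ (- + 6) (subst₂ _≤_ weight-on-list total (sumᶻ-distinct≤∑ n g g≥0 distinct)))
    where
    -- Shifting A r₁ k · A k r₂ by ∣A r₁ k∣ makes every term nonnegative, and 2 on positive 2-paths.
    g : Fin n → ℤ
    g k = A G r₁ k * A G k r₂ + + U r₁ k
    g≥0 : ∀ k → + 0 ≤ g k
    g≥0 k = i*j+∣i∣≥0 (entry G r₁ k) (entry G k r₂)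
    total : ∑ n g ≡ c + + 6
    total = trans (∑-distrib-+ n _ _) (cong₂ _+_ (non-edge r₁ r₂ r₁≢r₂ (U≡0⇒¬adj r₁≁r₂)) (regular r₁))
    positive-edge-in-nbhd : ∀ {x y} → A G v x ≡ + 1 → A G v y ≡ + 1 → U x y ≡ 1 → A G x y ≡ + 1
    positive-edge-in-nbhd v-x v-y x-y =
      trans (edge-sign (sign≢0 (inj₁ v-x)) (sign≢0 (inj₁ v-y)) (U≡1⇒adj x-y)) (cong₂ _*_ v-x v-y)
    g-at-v : g v ≡ + 2
    g-at-v rewrite symm G r₁ v | v-r₁ | v-r₂ = refl
    g-at-s : ∀ {s} → A G v s ≡ + 1 → U r₁ s ≡ 1 → U r₂ s ≡ 1 → g s ≡ + 2
    g-at-s {s} v-s r₁-s r₂-s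
      rewrite positive-edge-in-nbhd v-r₁ v-s r₁-s | positive-edge-in-nbhd v-s v-r₂ (u-flip r₂-s) = refl
    distinct : AllPairs _≢_ (v ∷ s₁ ∷ s₂ ∷ [])
    distinct = (adj⇒≢ (sign≢0 (inj₁ v-s₁)) ∷ adj⇒≢ (sign≢0 (inj₁ v-s₂)) ∷ []) ∷ (s₁≢s₂ ∷ []) ∷ [] ∷ []
    weight-on-list : sumᶻ (map g (v ∷ s₁ ∷ s₂ ∷ [])) ≡ + 6
    weight-on-list = cong₂ _+_ g-at-v (cong₂ _+_ (g-at-s v-s₁ r₁-s₁ r₂-s₁) (cong₂ _+_ (g-at-s v-s₂ r₁-s₂ r₂-s₂) refl))

  c-negative : Fin n → ¬ (+ 0 ≤ c)
  c-negative v c≥0 = from-no (+ 16 ℤ.≤? + 8) (subst₂ _≤_ lhs rhs (∑-mono-≤ n pointwise))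
    where
    -- 5 A + ∣A∣ is 2a on positive and 2b on negative edges; it sums to 5 ρ + 6 = 16, but 2 A² sums to 2 ρ² = 8.
    pointwise : ∀ j → + 5 * A G v j + + U v j ≤ + 2 * A² G v j
    pointwise j with v Fin.≟ j
    ... | yes refl rewrite noLoop G v | diagonal v = +≤+ z≤n
    ... | no v≢j with entry G v j
    ...   | inj₁ e        rewrite e | non-edge v j v≢j (λ v~j → v~j e) = ℤP.*-monoˡ-≤-nonNeg (+ 2) c≥0
    ...   | inj₂ (inj₁ e) rewrite e | positive-edge v j e = ℤP.≤-refl
    ...   | inj₂ (inj₂ e) rewrite e | negative-edge v j e = ℤP.≤-refl
    lhs : ∑ n (λ j → + 5 * A G v j + + U v j) ≡ + 16
    lhs = trans (∑-distrib-+ n _ _)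
      (cong₂ _+_ (trans (sym (*-distribˡ-∑ n (+ 5) (A G v))) (cong (+ 5 *_) (net-regular v))) (regular v))
    rhs : ∑ n (λ j → + 2 * A² G v j) ≡ + 8
    rhs = trans (sym (*-distribˡ-∑ n (+ 2) (A² G v))) (cong (+ 2 *_) (∑-A² net-regular v))

  no-vertex : Fin n → ⊥
  no-vertex v = c-negative v (diamond⇒c≥0 (positive-diamond v))

¬edgeless⇒vertex : ∀ {n} (G : SignedGraph n) → ¬ Edgeless G → Fin n
¬edgeless⇒vertex {zero}  G nonEmpty = ⊥-elim (nonEmpty (λ ()))
¬edgeless⇒vertex {suc n} G _        = zero

lemma3p19 : (n : ℕ) (G : SignedGraph n) (a b c : ℤ) →
    IsSRSG G 6 a b c →
    (InC₁ G a b c ⊎ InC₄ G a b c ⊎ InC₅ G a b c) →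
    Connected G → ¬ Complete G → Regular G 6 → NetRegular G (+ 2) →
    AllTrianglesBalanced G →
    ¬ (a ≡ + 3 × b ≡ - (+ 2))
lemma3p19 n G _ _ c (_ , nonEdgeless , diagonal , positive-edge , negative-edge , non-edge) _ _ _
  regular net-regular balanced (refl , refl) =
  Counterexample.no-vertex G c regular net-regular balanced diagonal positive-edge negative-edge non-edge (¬edgeless⇒vertex G nonEdgeless)
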